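{- Let $\mathbf{M}=(M;\leq,0,1)$ be a non-trivial complete lattice, let $S$ be a non-empty set and $R\subseteq S\times S$. Let $\widehat{T},\widehat{P}\colon M^S\to M^S$ be defined by $\widehat{T}(b)(s)=\bigwedge_M\{t(b)\mid sRt\}$ and $\widehat{P}(a)(t)=\bigvee_M\{s(a)\mid sRt\}$ for all $a,b\in M^S$ and $s,t\in S$. Then $R=R^{\widehat{P}}=R_{\widehat{T}}$.
   Context: Non-trivial means $0\neq 1$. $\mathbf{M}^S$ is ordered componentwise. For $s\in S$ and $m\in M^S$, $s(m)$ denotes the $s$-th component of $m$; $sRt$ means $(s,t)\in R$; the empty meet is $1$ and the empty join is $0$. For $T\colon M^S\to M^S$, $R_T=\{(s,t)\in S\times S\mid \forall b\in M^S:\ s(T(b))\leq t(b)\}$; for $P\colon M^S\to M^S$, $R^{P}=\{(s,t)\in S\times S\mid \forall a\in M^S:\ s(a)\leq t(P(a))\}$. -}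

module Defs where

open import Level using (Level; _⊔_; suc)
open import Data.Product using (Σ; _,_)
open import Data.Empty.Polymorphic using (⊥)
open import Relation.Binary.Core using (Rel)
open import Relation.Binary.Structures using (IsPartialOrder)
open import Relation.Nullary using (¬_)

record CompleteLattice (c ℓ₁ ℓ₂ ι : Level) : Set (suc (c ⊔ ℓ₁ ⊔ ℓ₂ ⊔ ι)) where
  infix 4 _≈_ _≤_
  field
    Carrier        : Set c
    _≈_            : Rel Carrier ℓ₁
    _≤_            : Rel Carrier ℓ₂
    isPartialOrder : IsPartialOrder _≈_ _≤_
    ⋀              : {I : Set ι} → (I → Carrier) → Carrier
    ⋀-lower        : {I : Set ι} (f : I → Carrier) (i : I) → ⋀ f ≤ f i
    ⋀-greatest     : {I : Set ι} (f : I → Carrier) (x : Carrier) →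
                     ((i : I) → x ≤ f i) → x ≤ ⋀ f
    ⋁              : {I : Set ι} → (I → Carrier) → Carrier
    ⋁-upper        : {I : Set ι} (f : I → Carrier) (i : I) → f i ≤ ⋁ f
    ⋁-least        : {I : Set ι} (f : I → Carrier) (x : Carrier) →
                     ((i : I) → f i ≤ x) → ⋁ f ≤ x

  𝟘 : Carrier
  𝟘 = ⋁ {I = ⊥} (λ ())

  𝟙 : Carrier
  𝟙 = ⋀ {I = ⊥} (λ ())

  NonTrivial : Set ℓ₁
  NonTrivial = ¬ (𝟘 ≈ 𝟙)

module _ {c ℓ₁ ℓ₂ ι : Level} (L : CompleteLattice c ℓ₁ ℓ₂ ι)
         {S : Set ι} (R : Rel S ι) where
  open CompleteLattice L

  -- M^S is represented as functions S → Carrier; s(m) is  m s.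

  T̂ : (S → Carrier) → (S → Carrier)
  T̂ b s = ⋀ {I = Σ S (λ t → R s t)} (λ { (t , _) → b t })

  P̂ : (S → Carrier) → (S → Carrier)
  P̂ a t = ⋁ {I = Σ S (λ s → R s t)} (λ { (s , _) → a s })

module _ {c ℓ₁ ℓ₂ ι : Level} (L : CompleteLattice c ℓ₁ ℓ₂ ι) {S : Set ι} where
  open CompleteLattice L

  Rlow : ((S → Carrier) → (S → Carrier)) → S → S → Set (c ⊔ ι ⊔ ℓ₂)
  Rlow T s t = (b : S → Carrier) → T b s ≤ b t

  Rup : ((S → Carrier) → (S → Carrier)) → S → S → Set (c ⊔ ι ⊔ ℓ₂)
  Rup P s t = (a : S → Carrier) → a s ≤ P a t

module Submission where

-- One inclusion is immediate: if s R t then s(a) is one of the joinands of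
-- P̂(a)(t), and t(b) one of the meetands of T̂(b)(s).
--
-- For the other inclusion we test against the characteristic function
-- χₛ of {s} (value 1 at s, 0 elsewhere) and its dual, the function χ̄ₜ
-- with value 0 at t and 1 elsewhere.  If s R t fails, every joinand of
-- P̂(χₛ)(t) is 0, so s(χₛ) = 1 ≤ t(P̂(χₛ)) = 0 contradicts non-triviality;
-- dually for T̂ with χ̄ₜ.  Constructively this yields ¬¬ (s R t), and
-- excluded middle (the only classical ingredient) turns it into s R t.

open import Defs
open import Level using (Level)
open import Data.Product using (_×_; _,_)
open import Data.Empty using (⊥-elim)
open import Relation.Binary.Core using (Rel)
open import Relation.Binary.Structures using (IsPartialOrder)
open import Relation.Binary.PropositionalEquality using (_≡_; refl)
open import Relation.Nullary using (¬_)
open import Function.Bundles using (_⇔_; mk⇔)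
open import Axiom.ExcludedMiddle using (ExcludedMiddle)
open import Axiom.DoubleNegationElimination using (DoubleNegationElimination; em⇒dne)

module LatticeFacts {c ℓ₁ ℓ₂ ι : Level} (L : CompleteLattice c ℓ₁ ℓ₂ ι) where
  open CompleteLattice L
  open IsPartialOrder isPartialOrder using (antisym)

  ⋁-empty : {I : Set ι} (f : I → Carrier) → ¬ I → (x : Carrier) → ⋁ f ≤ x
  ⋁-empty f empty x = ⋁-least f x (λ i → ⊥-elim (empty i))

  ⋀-empty : {I : Set ι} (f : I → Carrier) → ¬ I → (x : Carrier) → x ≤ ⋀ f
  ⋀-empty f empty x = ⋀-greatest f x (λ i → ⊥-elim (empty i))

  𝟘≤𝟙 : 𝟘 ≤ 𝟙
  𝟘≤𝟙 = ⋁-least _ 𝟙 (λ ())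

  𝟙≰𝟘 : NonTrivial → ¬ (𝟙 ≤ 𝟘)
  𝟙≰𝟘 nt 𝟙≤𝟘 = nt (antisym 𝟘≤𝟙 𝟙≤𝟘)

module CharacteristicFunctions {c ℓ₁ ℓ₂ ι : Level} (L : CompleteLattice c ℓ₁ ℓ₂ ι)
                               {S : Set ι} where
  open CompleteLattice L
  open LatticeFacts L

  -- χ s : S → M is the characteristic function of {s}: the join of 1 over
  -- the proposition u ≡ s, i.e. 1 at s and 0 elsewhere.
  χ : S → S → Carrier
  χ s u = ⋁ {I = u ≡ s} (λ _ → 𝟙)

  χ-at : (s : S) → 𝟙 ≤ χ s s
  χ-at s = ⋁-upper _ refl

  χ-off : {s u : S} → ¬ (u ≡ s) → χ s u ≤ 𝟘
  χ-off u≢s = ⋁-empty _ u≢s 𝟘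

  -- χ̄ t : S → M is the dual: the meet of 0 over u ≡ t, i.e. 0 at t, 1 elsewhere.
  χ̄ : S → S → Carrier
  χ̄ t u = ⋀ {I = u ≡ t} (λ _ → 𝟘)

  χ̄-at : (t : S) → χ̄ t t ≤ 𝟘
  χ̄-at t = ⋀-lower _ refl

  χ̄-off : {t u : S} → ¬ (u ≡ t) → 𝟙 ≤ χ̄ t u
  χ̄-off u≢t = ⋀-empty _ u≢t 𝟙

module Recovery {c ℓ₁ ℓ₂ ι : Level} (L : CompleteLattice c ℓ₁ ℓ₂ ι)
                {S : Set ι} (R : Rel S ι) where
  open CompleteLattice L
  open IsPartialOrder isPartialOrder using (trans)
  open LatticeFacts L
  open CharacteristicFunctions L

  R⊆Rup : {s t : S} → R s t → Rup L (P̂ L R) s t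
  R⊆Rup {s} r a = ⋁-upper _ (s , r)

  R⊆Rlow : {s t : S} → R s t → Rlow L (T̂ L R) s t
  R⊆Rlow {t = t} r b = ⋀-lower _ (t , r)

  P̂χ-vanishes : {s t : S} → ¬ R s t → P̂ L R (χ s) t ≤ 𝟘
  P̂χ-vanishes ¬rst = ⋁-least _ 𝟘 (λ { (u , rut) → χ-off (λ { refl → ¬rst rut }) })

  T̂χ̄-full : {s t : S} → ¬ R s t → 𝟙 ≤ T̂ L R (χ̄ t) s
  T̂χ̄-full ¬rst = ⋀-greatest _ 𝟙 (λ { (u , rsu) → χ̄-off (λ { refl → ¬rst rsu }) })

  Rup⊆¬¬R : NonTrivial → {s t : S} → Rup L (P̂ L R) s t → ¬ ¬ R s t
  Rup⊆¬¬R nt {s} h ¬rst = 𝟙≰𝟘 nt (trans (χ-at s) (trans (h (χ s)) (P̂χ-vanishes ¬rst)))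

  Rlow⊆¬¬R : NonTrivial → {s t : S} → Rlow L (T̂ L R) s t → ¬ ¬ R s t
  Rlow⊆¬¬R nt {t = t} h ¬rst = 𝟙≰𝟘 nt (trans (T̂χ̄-full ¬rst) (trans (h (χ̄ t)) (χ̄-at t)))

corollary2p8 : {c ℓ₁ ℓ₂ ι : Level} → ExcludedMiddle ι →
    (L : CompleteLattice c ℓ₁ ℓ₂ ι) → CompleteLattice.NonTrivial L →
    {S : Set ι} → S → (R : Rel S ι) →
    ((s t : S) → R s t ⇔ Rup L (P̂ L R) s t) ×
    ((s t : S) → R s t ⇔ Rlow L (T̂ L R) s t)
corollary2p8 {ι = ι} em L nt _ R =
    (λ _ _ → mk⇔ R⊆Rup (λ h → dne (Rup⊆¬¬R nt h)))
  , (λ _ _ → mk⇔ R⊆Rlow (λ h → dne (Rlow⊆¬¬R nt h)))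
  where
  open Recovery L R
  dne : DoubleNegationElimination ι
  dne = em⇒dne em
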